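{- For $\beta=(b_1,\dots,b_n)\in \mathrm{FR}_n$, define $\phi(\beta)=(a_1,\dots,a_n)$ by $a_i=b_i$ if $|\{1\leq j\leq i: b_j=b_i\}|=1$, and $a_i=b_i+k-2$ if $|\{1\leq j\leq i: b_j=b_i\}|=k>1$. Then $\phi(\beta)$ is a unit interval parking function of length $n$, i.e. $\phi$ is a well-defined map $\mathrm{FR}_n\to\mathrm{UPF}_n$.
   Context: Let $[n]=\{1,\dots,n\}$. A tuple $\beta=(b_1,\dots,b_n)\in[n]^n$ is a Fubini ranking of length $n$ if the smallest value of $\beta$ is $1$ and for every $x\in[n]$, if exactly $k>0$ entries of $\beta$ equal $x$, then the next largest value occurring in $\beta$ (if any) is $x+k$; $\mathrm{FR}_n$ is the set of these. Unit interval parking: $n$ cars enter in order $1,\dots,n$ a one-way street with spots $1,\dots,n$; given a preference list $\alpha=(a_1,\dots,a_n)\in[n]^n$, car $i$ drives to spot $a_i$ and parks there if it is free; otherwise it parks in spot $a_i+1$ if that spot exists and is free; otherwise it fails to park. $\alpha$ is a unit interval parking function if all cars park under this rule; $\mathrm{UPF}_n$ denotes the set of these. -}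

module Defs where

open import Data.Nat using (ℕ; zero; suc; _+_; _∸_; _≤_; _<_; _≟_)
open import Data.Nat.Properties using (_≤?_)
open import Data.List using (List; []; _∷_; length)
open import Relation.Binary.PropositionalEquality using (_≡_)
open import Data.List.Relation.Unary.All using (All)
open import Data.List.Membership.Propositional using (_∈_)
open import Data.List.Membership.DecPropositional _≟_ using (_∈?_)
open import Data.Maybe using (Maybe; just; nothing; is-just)
open import Data.Bool using (Bool; true; false)
open import Data.Product using (_×_; ∃-syntax)
open import Relation.Nullary using (yes; no)

InRange : ℕ → ℕ → Set
InRange n x = 1 ≤ x × x ≤ n

IsTuple : ℕ → List ℕ → Set
IsTuple n β = length β ≡ n × All (InRange n) β

occ : ℕ → List ℕ → ℕ
occ x [] = 0
occ x (y ∷ β) with y ≟ x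
... | yes _ = suc (occ x β)
... | no _ = occ x β

IsFubini : ℕ → List ℕ → Set
IsFubini n β =
  IsTuple n β
  -- the smallest value of β is 1 (all entries are ≥ 1 by IsTuple, and 1 occurs)
  × 1 ∈ β
  -- for x ∈ [n] with k = occ x β > 0, the next largest value occurring in β
  -- (if any) is x + k: i.e. every occurring y > x satisfies x + k ≤ y, and if
  -- some occurring value exceeds x then x + k occurs.
  × (∀ x → InRange n x → 0 < occ x β →
       (∀ y → y ∈ β → x < y → x + occ x β ≤ y)
     × ((∃[ y ] (y ∈ β × x < y)) → (x + occ x β) ∈ β))

parkCar : ℕ → List ℕ → ℕ → Maybe (List ℕ)
parkCar n occupied a with a ∈? occupied
... | no _ = just (a ∷ occupied)
... | yes _ with suc a ≤? n | suc a ∈? occupied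
...   | yes _ | no _ = just (suc a ∷ occupied)
...   | _     | _    = nothing

parkAll : ℕ → List ℕ → List ℕ → Maybe (List ℕ)
parkAll n occupied [] = just occupied
parkAll n occupied (a ∷ α) with parkCar n occupied a
... | nothing = nothing
... | just occupied′ = parkAll n occupied′ α

AllPark : ℕ → List ℕ → Set
AllPark n α = is-just (parkAll n [] α) ≡ true

IsUPF : ℕ → List ℕ → Set
IsUPF n α = IsTuple n α × AllPark n α

-- φ: 'seen' is the list of earlier entries b_1,…,b_{i-1}.
-- k = |{j ≤ i : b_j = b_i}| = occ b_i seen + 1;
-- a_i = b_i if k = 1, and a_i = b_i + k - 2 otherwise.
phiAux : List ℕ → List ℕ → List ℕ
phiAux seen [] = []
phiAux seen (b ∷ β) = a ∷ phiAux (b ∷ seen) β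
  where
    k : ℕ
    k = suc (occ b seen)
    a : ℕ
    a with k
    ... | suc zero = b
    ... | _ = b + k ∸ 2

phi : List ℕ → List ℕ
phi β = phiAux [] β

{-# OPTIONS --safe #-}
-- Call the interval of spots [x, x + occ x β) the block of a value x of β.  Under φ the
-- first car of value x prefers x, and its (c+1)-st car prefers x + c - 1, which its
-- predecessor has just taken, so it moves on to x + c: the cars of value x fill the block of
-- x from left to right.  So every car parks as long as the blocks are pairwise disjoint and
-- lie in [1, n].  The first Fubini condition makes them disjoint.  For the bound, every spot
-- up to the largest entry is covered by a block (the spot after a block starts the next one by
-- the second Fubini condition), so at least x - 1 entries lie below x and the block of x ends
-- by spot |{i : b_i ≤ x}| ≤ n.
module Submission where

open import Defs
open import Data.Nat using (ℕ; zero; suc; _+_; _∸_; _≤_; _<_; _≟_; _<?_; z≤n; s≤s)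
open import Data.Nat.Properties
open import Data.List using (List; []; _∷_; length)
open import Data.List.Relation.Unary.All as All using (All; []; _∷_)
open import Data.List.Relation.Unary.Any using (here; there)
open import Data.List.Membership.Propositional using (_∈_; _∉_)
open import Data.List.Membership.DecPropositional _≟_ using (_∈?_)
open import Data.Product using (_×_; _,_; proj₁; proj₂; ∃-syntax)
open import Data.Sum using (_⊎_; inj₁; inj₂)
open import Data.Maybe using (just; is-just)
open import Data.Bool using (true)
open import Function using (_∘_)
open import Function.Bundles using (_⇔_; mk⇔; Equivalence)
open import Relation.Nullary using (yes; no; contradiction)
open import Relation.Binary using (tri<; tri≈; tri>)
open import Relation.Binary.PropositionalEquality

occ-∷-≡ : ∀ x xs → occ x (x ∷ xs) ≡ suc (occ x xs)
occ-∷-≡ x xs with x ≟ x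
... | yes _   = refl
... | no x≢x = contradiction refl x≢x

occ-∷-≤ : ∀ x y xs → occ x xs ≤ occ x (y ∷ xs)
occ-∷-≤ x y xs with y ≟ x
... | yes _ = n≤1+n _
... | no _  = ≤-refl

occ>0⇒∈ : ∀ {x} xs → 0 < occ x xs → x ∈ xs
occ>0⇒∈ {x} (y ∷ xs) o>0 with y ≟ x
... | yes refl = here refl
... | no _     = there (occ>0⇒∈ xs o>0)

∈⇒occ>0 : ∀ {x xs} → x ∈ xs → 0 < occ x xs
∈⇒occ>0 {x} {xs = y ∷ xs} x∈ with y ≟ x | x∈
... | yes _ | _          = s≤s z≤n
... | no y≢x | here x≡y = contradiction (sym x≡y) y≢x
... | no _  | there x∈′ = ∈⇒occ>0 x∈′

countBelow : ℕ → List ℕ → ℕ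
countBelow t [] = 0
countBelow t (y ∷ xs) with y <? t
... | yes _ = suc (countBelow t xs)
... | no _  = countBelow t xs

countBelow-≤-length : ∀ t xs → countBelow t xs ≤ length xs
countBelow-≤-length t [] = z≤n
countBelow-≤-length t (y ∷ xs) with y <? t
... | yes _ = s≤s (countBelow-≤-length t xs)
... | no _  = m≤n⇒m≤1+n (countBelow-≤-length t xs)

countBelow-mono : ∀ {t u} xs → t ≤ u → countBelow t xs ≤ countBelow u xs
countBelow-mono [] _ = z≤n
countBelow-mono {t} {u} (y ∷ xs) t≤u with y <? t | y <? u
... | yes _   | yes _   = s≤s (countBelow-mono xs t≤u)
... | yes y<t | no y≮u = contradiction (<-≤-trans y<t t≤u) y≮u
... | no _    | yes _   = m≤n⇒m≤1+n (countBelow-mono xs t≤u)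
... | no _    | no _    = countBelow-mono xs t≤u

countBelow-suc : ∀ t xs → occ t xs + countBelow t xs ≤ countBelow (suc t) xs
countBelow-suc t [] = z≤n
countBelow-suc t (y ∷ xs) with y ≟ t | y <? t | y <? suc t
... | yes refl | yes y<y  | _         = contradiction y<y (n≮n y)
... | yes refl | no _     | yes _     = s≤s (countBelow-suc t xs)
... | yes refl | no _     | no y≮1+y = contradiction (n<1+n y) y≮1+y
... | no _     | yes _    | yes _     =
  ≤-trans (≤-reflexive (+-suc (occ t xs) _)) (s≤s (countBelow-suc t xs))
... | no _     | yes y<t  | no y≮1+t = contradiction (m<n⇒m<1+n y<t) y≮1+t
... | no _     | no _     | yes _     = m≤n⇒m≤1+n (countBelow-suc t xs)
... | no _     | no _     | no _      = countBelow-suc t xs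

block-end-≤ : ∀ {x} xs → x ≤ suc (countBelow x xs) →
              occ x xs + x ≤ suc (countBelow (suc x) xs)
block-end-≤ {x} xs x≤ = begin
  occ x xs + x                     ≤⟨ +-monoʳ-≤ (occ x xs) x≤ ⟩
  occ x xs + suc (countBelow x xs) ≡⟨ +-suc (occ x xs) _ ⟩
  suc (occ x xs + countBelow x xs) ≤⟨ s≤s (countBelow-suc x xs) ⟩
  suc (countBelow (suc x) xs)      ∎
  where open ≤-Reasoning

-- Blocks end at occ x xs + x rather than x + occ x xs so that the spot suc c + x of a
-- (c+1)-st car reduces to suc (c + x).
record InBlock (xs : List ℕ) (x p : ℕ) : Set where
  constructor block
  field
    lower : x ≤ p
    upper : p < occ x xs + x

Covered : List ℕ → ℕ → Set
Covered xs p = ∃[ x ] InBlock xs x p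

InBlock⇒occ>0 : ∀ {xs x p} → InBlock xs x p → 0 < occ x xs
InBlock⇒occ>0 {xs} {x} (block x≤p p<end) with occ x xs
... | zero  = contradiction x≤p (<⇒≱ p<end)
... | suc _ = s≤s z≤n

InBlock⇒∈ : ∀ {xs x p} → InBlock xs x p → x ∈ xs
InBlock⇒∈ {xs} = occ>0⇒∈ xs ∘ InBlock⇒occ>0

InBlock-start : ∀ {xs x} → 0 < occ x xs → InBlock xs x x
InBlock-start {x = x} o>0 = block ≤-refl (m<n+m x o>0)

InBlock-mono : ∀ {xs ys x p} → occ x xs ≤ occ x ys → InBlock xs x p → InBlock ys x p
InBlock-mono {x = x} o≤o′ (block x≤p p<end) =
  block x≤p (<-≤-trans p<end (+-monoˡ-≤ x o≤o′))

InBlock-∷-end : ∀ b xs → InBlock (b ∷ xs) b (occ b xs + b)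
InBlock-∷-end b xs =
  block (m≤n+m b _) (subst (λ o → occ b xs + b < o + b) (sym (occ-∷-≡ b xs)) (n<1+n _))

InBlock-∷⁻ : ∀ {b xs x p} → InBlock (b ∷ xs) x p → InBlock xs x p ⊎ p ≡ occ b xs + b
InBlock-∷⁻ {b} {xs} {x} {p} (block x≤p p<end) with b ≟ x
... | no _ = inj₁ (block x≤p p<end)
... | yes refl with p ≟ occ b xs + b
...   | yes p≡end = inj₂ p≡end
...   | no p≢end  = inj₁ (block x≤p (≤∧≢⇒< (≤-pred p<end) p≢end))

Occupies : List ℕ → List ℕ → Set
Occupies xs O = ∀ p → p ∈ O ⇔ Covered xs p

occupies-[] : Occupies [] []
occupies-[] p = mk⇔ (λ ()) (λ (_ , blk) → contradiction (InBlock⇒occ>0 blk) n≮0)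

occupies-∷ : ∀ {b xs O} → Occupies xs O → Occupies (b ∷ xs) (occ b xs + b ∷ O)
occupies-∷ {b} {xs} {O} occupies p = mk⇔ to from
  where
    to : p ∈ occ b xs + b ∷ O → Covered (b ∷ xs) p
    to (here refl) = b , InBlock-∷-end b xs
    to (there p∈O) with Equivalence.to (occupies p) p∈O
    ... | x , blk = x , InBlock-mono (occ-∷-≤ x b xs) blk
    from : Covered (b ∷ xs) p → p ∈ occ b xs + b ∷ O
    from (x , blk) with InBlock-∷⁻ blk
    ... | inj₁ blk′ = there (Equivalence.from (occupies p) (x , blk′))
    ... | inj₂ p≡end = here p≡end

record Splits (β seen rest : List ℕ) : Set where
  constructor splitting
  field occ-split : ∀ x → occ x seen + occ x rest ≡ occ x β

splits-∷ : ∀ {β seen b rest} → Splits β seen (b ∷ rest) → Splits β (b ∷ seen) rest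
splits-∷ {seen = seen} {b} {rest} (splitting occ-split) = splitting split′
  where
    split′ : ∀ x → occ x (b ∷ seen) + occ x rest ≡ _
    split′ x with b ≟ x | occ-split x
    ... | yes _ | eq = trans (sym (+-suc (occ x seen) (occ x rest))) eq
    ... | no _  | eq = eq

occ-≤-splits : ∀ {β seen rest} → Splits β seen rest → ∀ x → occ x seen ≤ occ x β
occ-≤-splits {seen = seen} (splitting occ-split) x =
  subst (occ x seen ≤_) (occ-split x) (m≤m+n _ _)

occ-<-splits : ∀ {β seen b rest} → Splits β seen (b ∷ rest) → occ b seen < occ b β
occ-<-splits {seen = seen} {b} {rest} (splitting occ-split) =
  subst (occ b seen <_) (trans (cong (occ b seen +_) (sym (occ-∷-≡ b rest))) (occ-split b))
        (m<m+n (occ b seen) (s≤s z≤n))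

-- The entry a_i of φ for the (c+1)-st occurrence of b among b_1, …, b_i.
preference : ℕ → ℕ → ℕ
preference b zero    = b
preference b (suc c) = c + b

phiAux-∷ : ∀ seen b rest →
           phiAux seen (b ∷ rest) ≡ preference b (occ b seen) ∷ phiAux (b ∷ seen) rest
-- The catch-all clause of phiAux recomputes its k from occ b seen, hence the `in eq`.
phiAux-∷ seen b rest with occ b seen in eq
... | zero  = refl
... | suc c = cong (_∷ phiAux (b ∷ seen) rest)
                (trans (cong (λ o → b + suc o ∸ 2) eq) (cong (_∸ 2) (+-comm b (suc (suc c)))))

preference-inRange : ∀ {n} b c → InRange n b → InRange n (c + b) →
                     InRange n (preference b c)
preference-inRange b zero    b∈[n] _         = b∈[n]
preference-inRange b (suc c) (1≤b , _) (_ , 1+c+b≤n) =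
  ≤-trans 1≤b (m≤n+m b c) , ≤-trans (n≤1+n _) 1+c+b≤n

parkCar-free : ∀ {n O a} → a ∉ O → parkCar n O a ≡ just (a ∷ O)
parkCar-free {n} {O} {a} a∉O with a ∈? O
... | yes a∈O = contradiction a∈O a∉O
... | no _    = refl

parkCar-next : ∀ {n O a} → a ∈ O → suc a ≤ n → suc a ∉ O →
               parkCar n O a ≡ just (suc a ∷ O)
parkCar-next {n} {O} {a} a∈O 1+a≤n 1+a∉O with a ∈? O
... | no a∉O = contradiction a∈O a∉O
... | yes _ with suc a ≤? n | suc a ∈? O
...   | yes _    | no _      = refl
...   | no 1+a≰n | _         = contradiction 1+a≤n 1+a≰n
...   | yes _    | yes 1+a∈O = contradiction 1+a∈O 1+a∉O

parkAll-∷ : ∀ {n O O′ a α} → parkCar n O a ≡ just O′ →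
            parkAll n O (a ∷ α) ≡ parkAll n O′ α
parkAll-∷ {n} {O} {a = a} parked with parkCar n O a | parked
... | just _ | refl = refl

BlocksDisjoint : List ℕ → Set
BlocksDisjoint β = ∀ {x y p} → InBlock β x p → InBlock β y p → x ≡ y

BlocksWithin : ℕ → List ℕ → Set
BlocksWithin n β = ∀ {x p} → InBlock β x p → InRange n p

length-phiAux : ∀ seen rest → length (phiAux seen rest) ≡ length rest
length-phiAux seen []         = refl
length-phiAux seen (b ∷ rest) = cong suc (length-phiAux (b ∷ seen) rest)

module _ {n β} (disjoint : BlocksDisjoint β) (within : BlocksWithin n β) where

  spot-inBlock : ∀ {seen b rest} → Splits β seen (b ∷ rest) → InBlock β b (occ b seen + b)
  spot-inBlock {b = b} splits = block (m≤n+m b _) (+-monoˡ-< b (occ-<-splits splits))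

  spot-free : ∀ {seen b rest O} → Occupies seen O → Splits β seen (b ∷ rest) →
              occ b seen + b ∉ O
  spot-free occupies splits spot∈O with Equivalence.to (occupies _) spot∈O
  ... | x , blk with disjoint (InBlock-mono (occ-≤-splits splits x) blk) (spot-inBlock splits)
  ... | refl = n≮n _ (InBlock.upper blk)

  parkCar-spot : ∀ {seen b rest O} → Occupies seen O → Splits β seen (b ∷ rest) →
                 parkCar n O (preference b (occ b seen)) ≡ just (occ b seen + b ∷ O)
  parkCar-spot {seen} {b} {O = O} occupies splits
    with occ b seen in eq | spot-free occupies splits | spot-inBlock splits
  ... | zero  | spot∉O | _   = parkCar-free spot∉O
  ... | suc c | spot∉O | blk = parkCar-next previous∈O (proj₂ (within blk)) spot∉O
    where
      previous∈O : c + b ∈ O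
      previous∈O = Equivalence.from (occupies _)
        (b , block (m≤n+m b c) (subst (λ o → c + b < o + b) (sym eq) ≤-refl))

  phiAux-parks : ∀ seen rest O → Occupies seen O → Splits β seen rest →
                 is-just (parkAll n O (phiAux seen rest)) ≡ true
  phiAux-parks seen []         O _         _      = refl
  phiAux-parks seen (b ∷ rest) O occupies splits = begin
    is-just (parkAll n O (phiAux seen (b ∷ rest)))
      ≡⟨ cong (is-just ∘ parkAll n O) (phiAux-∷ seen b rest) ⟩
    is-just (parkAll n O (preference b (occ b seen) ∷ phiAux (b ∷ seen) rest))
      ≡⟨ cong is-just (parkAll-∷ {O = O} {α = phiAux (b ∷ seen) rest}
                                (parkCar-spot occupies splits)) ⟩
    is-just (parkAll n (occ b seen + b ∷ O) (phiAux (b ∷ seen) rest))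
      ≡⟨ phiAux-parks (b ∷ seen) rest _ (occupies-∷ occupies) (splits-∷ splits) ⟩
    true ∎
    where open ≡-Reasoning

  phiAux-inRange : ∀ seen rest → Splits β seen rest → All (InRange n) (phiAux seen rest)
  phiAux-inRange seen []         _      = []
  phiAux-inRange seen (b ∷ rest) splits rewrite phiAux-∷ seen b rest =
    preference-inRange b (occ b seen)
      (within (InBlock-start (≤-<-trans z≤n (occ-<-splits splits))))
      (within (spot-inBlock splits))
    ∷ phiAux-inRange (b ∷ seen) rest (splits-∷ splits)

  phi-UPF : length β ≡ n → IsUPF n (phi β)
  phi-UPF length≡n =
    (trans (length-phiAux [] β) length≡n , phiAux-inRange [] β (splitting λ _ → refl)) ,
    phiAux-parks [] β [] occupies-[] (splitting λ _ → refl)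

module Fubini {n β} (fubini : IsFubini n β) where

  private
    inRange : ∀ {x} → x ∈ β → InRange n x
    inRange = All.lookup (proj₂ (proj₁ fubini))

    next-value-≥ : ∀ {x y} → x ∈ β → y ∈ β → x < y → occ x β + x ≤ y
    next-value-≥ {x} {y} x∈ y∈ x<y =
      subst (_≤ y) (+-comm x _)
            (proj₁ (proj₂ (proj₂ fubini) x (inRange x∈) (∈⇒occ>0 x∈)) y y∈ x<y)

    next-value-∈ : ∀ {x y} → x ∈ β → y ∈ β → x < y → occ x β + x ∈ β
    next-value-∈ {x} {y} x∈ y∈ x<y =
      subst (_∈ β) (+-comm x _)
            (proj₂ (proj₂ (proj₂ fubini) x (inRange x∈) (∈⇒occ>0 x∈)) (y , y∈ , x<y))

  block-before : ∀ {x y p} → InBlock β x p → InBlock β y p → x < y → occ x β + x ≤ p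
  block-before x-blk y-blk x<y =
    ≤-trans (next-value-≥ (InBlock⇒∈ x-blk) (InBlock⇒∈ y-blk) x<y) (InBlock.lower y-blk)

  blocksDisjoint : BlocksDisjoint β
  blocksDisjoint {x} {y} x-blk y-blk with <-cmp x y
  ... | tri< x<y _ _ = contradiction (block-before x-blk y-blk x<y) (<⇒≱ (InBlock.upper x-blk))
  ... | tri≈ _ x≡y _ = x≡y
  ... | tri> _ _ y<x = contradiction (block-before y-blk x-blk y<x) (<⇒≱ (InBlock.upper y-blk))

  covering-block : ∀ {p y} → 1 ≤ p → y ∈ β → p ≤ y →
                   ∃[ x ] InBlock β x p × x ≤ suc (countBelow x β)
  covering-block {suc zero} _ _ _ =
    1 , InBlock-start (∈⇒occ>0 (proj₁ (proj₂ fubini))) , s≤s z≤n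
  covering-block {suc (suc m)} {y} _ y∈ 2+m≤y
    with covering-block {suc m} (s≤s z≤n) y∈ (<⇒≤ 2+m≤y)
  ... | x , x-blk@(block x≤1+m 1+m<end) , x-low with suc (suc m) <? occ x β + x
  ...   | yes 2+m<end = x , block (m≤n⇒m≤1+n x≤1+m) 2+m<end , x-low
  ...   | no 2+m≮end =
    subst (λ p → ∃[ x′ ] InBlock β x′ p × x′ ≤ suc (countBelow x′ β)) end≡2+m
          (end , InBlock-start (∈⇒occ>0 end∈) , end-low)
    where
      end = occ x β + x
      end≡2+m : end ≡ suc (suc m)
      end≡2+m = ≤-antisym (≮⇒≥ 2+m≮end) 1+m<end
      x<end : x < end
      x<end = m<n+m x (InBlock⇒occ>0 x-blk)
      end∈ : end ∈ β
      end∈ = next-value-∈ (InBlock⇒∈ x-blk) y∈ (≤-<-trans x≤1+m 2+m≤y)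
      end-low : end ≤ suc (countBelow end β)
      end-low = ≤-trans (block-end-≤ β x-low) (s≤s (countBelow-mono β x<end))

  blocksWithin : BlocksWithin n β
  blocksWithin {x} {p} blk = ≤-trans 1≤x (InBlock.lower blk) , p≤n
    where
      x∈ = InBlock⇒∈ blk
      1≤x = proj₁ (inRange x∈)
      x-low : x ≤ suc (countBelow x β)
      x-low with covering-block 1≤x x∈ ≤-refl
      ... | x′ , x′-blk , x′-low
        with blocksDisjoint x′-blk (InBlock-start (∈⇒occ>0 x∈))
      ...   | refl = x′-low
      p≤n : p ≤ n
      p≤n = ≤-pred (begin-strict
        p                           <⟨ InBlock.upper blk ⟩
        occ x β + x                 ≤⟨ block-end-≤ β x-low ⟩
        suc (countBelow (suc x) β)  ≤⟨ s≤s (countBelow-≤-length (suc x) β) ⟩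
        suc (length β)              ≡⟨ cong suc (proj₁ (proj₁ fubini)) ⟩
        suc n                       ∎)
        where open ≤-Reasoning

lemma2p6 : (n : ℕ) (β : List ℕ) → IsFubini n β → IsUPF n (phi β)
lemma2p6 n β fubini = phi-UPF blocksDisjoint blocksWithin (proj₁ (proj₁ fubini))
  where open Fubini fubini
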